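{- For every triple $(D,T,L)$, $\mathrm{ML}(D,T,L)=\mathrm{ML}(\hat D(T,L),T,L)$.
   Context: An out-tree of a digraph $D$ is a subgraph $T$ that is an oriented tree with exactly one vertex of in-degree zero (its root); its leaves are its vertices of out-degree zero in $T$; $\mathrm{Int}(T)$ is the set of non-leaf vertices of $T$. An out-branching is a spanning out-tree. A triple $(D,T,L)$ consists of a digraph $D$, an out-tree $T$ of $D$ and a set $L\subseteq V(D)\setminus\mathrm{Int}(T)$. For a digraph $H$ containing $T$, a $(T,L)$-out-branching of $H$ is an out-branching $T'$ of $H$ with $A(T)\subseteq A(T')$, every vertex of $L$ a leaf of $T'$, and the same root as $T$; $\mathrm{ML}(H,T,L)$ is the maximum number of leaves of a $(T,L)$-out-branching of $H$, and $0$ if none exists. $\hat D(T,L)$ is the subgraph of $D$ obtained by deleting all arcs leaving vertices of $L$ and all arcs not in $A(T)$ whose head lies in $V(T)$. -}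

module Defs where

open import Data.Nat using (ℕ; zero; suc; _+_)
open import Data.Fin using (Fin; zero; suc; inject₁; fromℕ)
open import Data.Bool using (Bool; true; false; _∧_; _∨_; not; if_then_else_)
open import Data.List using (List; allFin; map)
open import Data.Bool.ListAction using (any)
open import Data.Nat.ListAction using (sum)
open import Data.Product using (Σ; ∃; _×_; _,_)
open import Data.Sum using (_⊎_)
open import Data.Empty using (⊥)
open import Relation.Nullary using (¬_)
open import Relation.Binary.PropositionalEquality using (_≡_)
open import Relation.Binary.Construct.Closure.ReflexiveTransitive using (Star)
open import Function.Definitions using (Injective)

Digraph : ℕ → Set
Digraph n = Fin n → Fin n → Bool

record Sub (n : ℕ) : Set where
  constructor sub
  field
    V : Fin n → Bool
    A : Fin n → Fin n → Bool
open Sub public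

IsSubgraphOf : ∀ {n} → Sub n → Digraph n → Set
IsSubgraphOf {n} S D =
  ∀ (u v : Fin n) → A S u v ≡ true → (V S u ≡ true × V S v ≡ true × D u v ≡ true)

Adjacent : ∀ {n} → Sub n → Fin n → Fin n → Set
Adjacent S u v = (A S u v ≡ true) ⊎ (A S v u ≡ true)

Oriented : ∀ {n} → Sub n → Set
Oriented {n} S = (∀ (u : Fin n) → A S u u ≡ false)
  × (∀ (u v : Fin n) → ¬ (A S u v ≡ true × A S v u ≡ true))

Connected : ∀ {n} → Sub n → Set
Connected {n} S = ∀ (u v : Fin n) → V S u ≡ true → V S v ≡ true → Star (Adjacent S) u v

-- a cycle of length k+3 in the underlying graph: distinct vertices
-- c 0, ..., c (k+2) with consecutive ones (cyclically) adjacent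
record UCycle {n} (S : Sub n) : Set where
  field
    k     : ℕ
    c     : Fin (suc (suc (suc k))) → Fin n
    inj   : Injective _≡_ _≡_ c
    step  : ∀ (i : Fin (suc (suc k))) → Adjacent S (c (inject₁ i)) (c (suc i))
    close : Adjacent S (c (fromℕ (suc (suc k)))) (c zero)

Acyclic : ∀ {n} → Sub n → Set
Acyclic S = ¬ UCycle S

OrientedTree : ∀ {n} → Sub n → Set
OrientedTree {n} S = Oriented S × Connected S × Acyclic S × (∃ λ (v : Fin n) → V S v ≡ true)

UniqueSource : ∀ {n} → Sub n → Fin n → Set
UniqueSource {n} S r = V S r ≡ true × (∀ (u : Fin n) → A S u r ≡ false)
  × (∀ (w : Fin n) → V S w ≡ true → (∀ (u : Fin n) → A S u w ≡ false) → w ≡ r)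

OutTree : ∀ {n} → Digraph n → Sub n → Fin n → Set
OutTree D S r = IsSubgraphOf S D × OrientedTree S × UniqueSource S r

isLeaf : ∀ {n} → Sub n → Fin n → Bool
isLeaf {n} S v = V S v ∧ not (any (A S v) (allFin n))

isInt : ∀ {n} → Sub n → Fin n → Bool
isInt S v = V S v ∧ not (isLeaf S v)

numLeaves : ∀ {n} → Sub n → ℕ
numLeaves {n} S = sum (map (λ v → if isLeaf S v then 1 else 0) (allFin n))

Triple : ∀ {n} → Digraph n → Sub n → Fin n → (Fin n → Bool) → Set
Triple {n} D T r L = OutTree D T r × (∀ (v : Fin n) → L v ≡ true → isInt T v ≡ false)

TLOutBranching : ∀ {n} → Digraph n → Sub n → Fin n → (Fin n → Bool) → Sub n → Set
TLOutBranching {n} H T r L T' =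
  (∀ (v : Fin n) → V T' v ≡ true)
  × OutTree H T' r
  × (∀ (u v : Fin n) → A T u v ≡ true → A T' u v ≡ true)
  × (∀ (v : Fin n) → L v ≡ true → isLeaf T' v ≡ true)

-- m = ML(H,T,L): the maximum number of leaves of a (T,L)-out-branching of H,
-- and 0 if there is none.
IsML : ∀ {n} → Digraph n → Sub n → Fin n → (Fin n → Bool) → ℕ → Set
IsML {n} H T r L m =
  ((∀ (T' : Sub n) → ¬ TLOutBranching H T r L T') × m ≡ 0)
  ⊎ ((∃ λ (T' : Sub n) → TLOutBranching H T r L T' × numLeaves T' ≡ m)
     × (∀ (T' : Sub n) → TLOutBranching H T r L T' → numLeaves T' Data.Nat.≤ m))

hat : ∀ {n} → Digraph n → Sub n → (Fin n → Bool) → Digraph n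
hat D T L u v = D u v ∧ not (L u) ∧ (not (V T v) ∨ A T u v)

module Submission where

-- In an out-branching every vertex has at most one in-arc: following in-arcs backwards from any
-- vertex must reach the unique source r (a closed orbit would carry an undirected cycle), and two
-- in-arcs a → v ← b give a cycle through v, b, the paths from b and from a up to r, and a.
-- So in a (T,L)-out-branching T' of D, an arc into V(T) that is not in A(T) would give its head
-- a second in-arc (the one from T) or an in-arc at the root, and no arc leaves a vertex of L, a
-- leaf of T'. Hence D and D̂(T,L) have the same (T,L)-out-branchings.

open import Defs
open import Level using (0ℓ)
open import Data.Nat using (ℕ; zero; suc; _+_; _≤_; _<_; z≤n; s≤s)
open import Data.Nat.Properties using (anyUpTo?; n<1+n; +-suc; +-monoʳ-≤; ≤-trans; m≤n⇒m≤1+n; m≤n⇒∃[o]m+o≡n)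
open import Data.Nat.GeneralisedArithmetic using (iterate)
open import Data.Fin using (Fin; zero; suc; inject₁; fromℕ; toℕ; _≟_)
open import Data.Fin.Properties using (any?; pigeonhole; toℕ≤pred[n])
open import Data.Bool using (Bool; true; false; not)
open import Data.Bool.Properties using (¬-not; not-¬; not-injective; ∧-conicalˡ; ∧-conicalʳ; ∨-conicalˡ; ∨-conicalʳ; ∨-zeroʳ)
  renaming (_≟_ to _≟ᵇ_)
open import Data.Bool.ListAction using (any)
open import Data.List using (_∷_; allFin)
open import Data.List.Relation.Unary.Any using (here; there)
open import Data.List.Membership.Propositional using (_∈_)
open import Data.List.Membership.Propositional.Properties using (∈-allFin)
open import Data.Product using (Σ-syntax; ∃-syntax; ∃₂; _×_; _,_; proj₁; proj₂)
open import Data.Sum using (_⊎_; inj₁; inj₂; [_,_]′)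
open import Function using (_∘_; const)
open import Function.Bundles using (_⇔_; mk⇔)
open import Function.Definitions using (Injective)
open import Relation.Nullary using (¬_; yes; no; contradiction)
open import Relation.Unary using (Decidable)
open import Relation.Binary.Core using (Rel)
open import Relation.Binary.PropositionalEquality using (_≡_; _≢_; refl; sym; trans; cong; subst; subst₂)
open import Relation.Binary.Construct.Closure.ReflexiveTransitive using (Star; ε; _◅_; _◅◅_; reverse)

least-witness : ∀ {p} {P : ℕ → Set p} → Decidable P → ∀ k → P k →
                ∃[ j ] j ≤ k × P j × (∀ i → i < j → ¬ P i)
least-witness P? k Pk with P? 0
... | yes P0 = 0 , z≤n , P0 , λ _ ()
least-witness P? zero    Pk | no ¬P0 = contradiction Pk ¬P0
least-witness {P = P} P? (suc k) Pk | no ¬P0 with least-witness {P = P ∘ suc} (P? ∘ suc) k Pk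
... | j , j≤k , Pj , below = suc j , s≤s j≤k , Pj , λ { zero _ → ¬P0 ; (suc i) (s≤s i<j) → below i i<j }

iterate-+ : ∀ {a} {A : Set a} (f : A → A) x m {k} → iterate f x (m + k) ≡ iterate f (iterate f x m) k
iterate-+ f x zero    = refl
iterate-+ f x (suc m) = iterate-+ f (f x) m

orbit-path : ∀ {a ℓ} {A : Set a} {R : Rel A ℓ} (f : A → A) k x →
             (∀ s → s < k → R (iterate f x s) (f (iterate f x s))) → Star R x (iterate f x k)
orbit-path f zero    x steps = ε
orbit-path f (suc k) x steps = steps 0 (s≤s z≤n) ◅ orbit-path f k (f x) (λ s s<k → steps (suc s) (s≤s s<k))

orbit-returns : ∀ {n} (f : Fin n → Fin n) x →
                ∃₂ λ i o → i + suc o ≤ n × iterate f x (i + suc o) ≡ iterate f x i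
orbit-returns {n} f x with pigeonhole (n<1+n n) (λ k → iterate f x (toℕ k))
... | i , j , i<j , same with m≤n⇒∃[o]m+o≡n i<j
... | o , 1+i+o≡j = toℕ i , o , subst (_≤ n) (sym i+[1+o]≡j) (toℕ≤pred[n] j)
                  , trans (cong (iterate f x) i+[1+o]≡j) (sym same)
  where
    i+[1+o]≡j : toℕ i + suc o ≡ toℕ j
    i+[1+o]≡j = trans (+-suc (toℕ i) o) 1+i+o≡j

any-false⇒false : ∀ {a} {A : Set a} (f : A → Bool) {x} xs → x ∈ xs → any f xs ≡ false → f x ≡ false
any-false⇒false f (y ∷ ys) (here refl)  none = ∨-conicalˡ (f y) _ none
any-false⇒false f (y ∷ ys) (there x∈ys) none = any-false⇒false f ys x∈ys (∨-conicalʳ (f y) _ none)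

leaf-has-no-out-arc : ∀ {n} {S : Sub n} {u} w → isLeaf S u ≡ true → A S u w ≡ false
leaf-has-no-out-arc {n} {S} {u} w leaf =
  any-false⇒false (A S u) (allFin n) (∈-allFin w) (not-injective (∧-conicalʳ (V S u) _ leaf))

module SimpleWalks {n ℓ} (R : Rel (Fin n) ℓ) where

  mutual
    data SimpleWalk : Fin n → Fin n → ℕ → Set ℓ where
      stop : ∀ x → SimpleWalk x x zero
      cons : ∀ {x y z k} → R x y → (w : SimpleWalk y z k) → (∀ i → vertex w i ≢ x) → SimpleWalk x z (suc k)

    vertex : ∀ {x z k} → SimpleWalk x z k → Fin (suc k) → Fin n
    vertex (stop x)              zero    = x
    vertex (cons {x = x} _ _ _)  zero    = x
    vertex (cons _ w _)          (suc i) = vertex w i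

  vertex-head : ∀ {x z k} (w : SimpleWalk x z k) → vertex w zero ≡ x
  vertex-head (stop x)     = refl
  vertex-head (cons _ _ _) = refl

  vertex-last : ∀ {x z k} (w : SimpleWalk x z k) → vertex w (fromℕ k) ≡ z
  vertex-last (stop x)     = refl
  vertex-last (cons _ w _) = vertex-last w

  vertex-step : ∀ {x z k} (w : SimpleWalk x z k) (i : Fin k) → R (vertex w (inject₁ i)) (vertex w (suc i))
  vertex-step (cons e w _) zero    = subst (R _) (sym (vertex-head w)) e
  vertex-step (cons _ w _) (suc i) = vertex-step w i

  vertex-injective : ∀ {x z k} (w : SimpleWalk x z k) → Injective _≡_ _≡_ (vertex w)
  vertex-injective (stop x)     {zero}  {zero}  _  = refl
  vertex-injective (cons _ _ _) {zero}  {zero}  _  = refl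
  vertex-injective (cons _ _ f) {zero}  {suc j} eq = contradiction (sym eq) (f j)
  vertex-injective (cons _ _ f) {suc i} {zero}  eq = contradiction eq (f i)
  vertex-injective (cons _ w _) {suc i} {suc j} eq = cong suc (vertex-injective w eq)

  suffix : ∀ {x y z k} (w : SimpleWalk y z k) i → vertex w i ≡ x → ∃[ k' ] SimpleWalk x z k'
  suffix (stop _)       zero    refl = _ , stop _
  suffix w@(cons _ _ _) zero    refl = _ , w
  suffix (cons _ w _)   (suc i) eq   = suffix w i eq

  simplify : ∀ {x z} → Star R x z → ∃[ k ] SimpleWalk x z k
  simplify ε = 0 , stop _
  simplify {x} (e ◅ walk) with simplify walk
  ... | k , w with any? (λ i → vertex w i ≟ x)
  ...   | yes (i , revisits) = suffix w i revisits
  ...   | no fresh           = suc k , cons e w (λ i eq → fresh (i , eq))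

EdgeFree : ∀ {n} → Sub n → Fin n → Fin n → Rel (Fin n) 0ℓ
EdgeFree S s t u w = Adjacent S u w × ¬ (u ≡ s × w ≡ t) × ¬ (u ≡ t × w ≡ s)

EdgeFree-sym : ∀ {n} {S : Sub n} {s t u w} → EdgeFree S s t u w → EdgeFree S s t w u
EdgeFree-sym (adj , not-st , not-ts) =
  [ inj₂ , inj₁ ]′ adj , (λ (w≡s , u≡t) → not-ts (u≡t , w≡s)) , (λ (w≡t , u≡s) → not-st (u≡s , w≡t))

module _ {n} (S : Sub n) {s t : Fin n} where
  open SimpleWalks (EdgeFree S s t)

  detour⇒UCycle : s ≢ t → Adjacent S s t → Star (EdgeFree S s t) t s → UCycle S
  detour⇒UCycle s≢t s~t walk = close (proj₂ (simplify walk))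
    where
      close : ∀ {k} → SimpleWalk t s k → UCycle S
      close (stop _)                             = contradiction refl s≢t
      close (cons (_ , _ , not-ts) (stop _) _)   = contradiction (refl , refl) not-ts
      close {suc (suc k)} w@(cons _ (cons _ _ _) _) = record
        { k     = k
        ; c     = vertex w
        ; inj   = vertex-injective w
        ; step  = proj₁ ∘ vertex-step w
        ; close = subst₂ (Adjacent S) (sym (vertex-last w)) (sym (vertex-head w)) s~t
        }

module OutTreeProperties {n} {H : Digraph n} {S : Sub n} {r : Fin n} (out : OutTree H S r) where

  loop-free : ∀ u → A S u u ≡ false
  loop-free = let (_ , ((loops , _) , _) , _) = out in loops

  antisymmetric : ∀ u w → ¬ (A S u w ≡ true × A S w u ≡ true)
  antisymmetric = let (_ , ((_ , anti) , _) , _) = out in anti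

  acyclic : ¬ UCycle S
  acyclic = let (_ , (_ , _ , acyc , _) , _) = out in acyc

  root-has-no-in-arc : ∀ u → A S u r ≡ false
  root-has-no-in-arc = let (_ , _ , (_ , none , _)) = out in none

  root-unique : ∀ w → V S w ≡ true → (∀ u → A S u w ≡ false) → w ≡ r
  root-unique = let (_ , _ , (_ , _ , unique)) = out in unique

  in-arc : ∀ w → V S w ≡ true → w ≢ r → ∃[ u ] A S u w ≡ true
  in-arc w Vw w≢r with any? (λ u → A S u w ≟ᵇ true)
  ... | yes found = found
  ... | no none   = contradiction (root-unique w Vw (λ u → ¬-not (λ u→w → none (u , u→w)))) w≢r

  module _ (p : Fin n → Fin n) (p-arc : ∀ w → w ≢ r → A S (p w) w ≡ true) where

    -- With the least return time j, no step of the orbit p y → … → y uses the edge {y, p y}.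
    periodic-orbit⇒UCycle : ∀ y k → iterate p (p y) k ≡ y → (∀ s → s ≤ k → iterate p y s ≢ r) → UCycle S
    periodic-orbit⇒UCycle y k returns avoids with least-witness (λ j → iterate p (p y) j ≟ y) k returns
    ... | j , j≤k , returnsʲ , earlier =
      detour⇒UCycle S y≢py (inj₂ py→y) (subst (Star _ (p y)) returnsʲ (orbit-path p j (p y) step))
      where
        py→y : A S (p y) y ≡ true
        py→y = p-arc y (avoids 0 z≤n)

        y≢py : y ≢ p y
        y≢py y≡py = not-¬ (loop-free y) (subst (λ u → A S u y ≡ true) (sym y≡py) py→y)

        step : ∀ s → s < j → EdgeFree S y (p y) (iterate p (p y) s) (p (iterate p (p y) s))
        step s s<j = inj₂ z-arc
                   , (λ (z≡y , _) → earlier s s<j z≡y)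
                   , (λ (z≡py , pz≡y) → antisymmetric (p y) y
                        (py→y , subst₂ (λ u w → A S u w ≡ true) pz≡y z≡py z-arc))
          where
            z-arc : A S (p (iterate p (p y) s)) (iterate p (p y) s) ≡ true
            z-arc = p-arc _ (avoids (suc s) (≤-trans s<j j≤k))

    orbit-reaches-root : ∀ x → ∃[ k ] iterate p x k ≡ r
    orbit-reaches-root x with anyUpTo? (λ k → iterate p x k ≟ r) (suc n)
    ... | yes (k , _ , hits) = k , hits
    ... | no misses with orbit-returns p x
    ...   | i , o , i+1+o≤n , returns =
      contradiction (periodic-orbit⇒UCycle (iterate p x i) o (trans (sym (iterate-+ p x i)) returns) avoids) acyclic
      where
        avoids : ∀ s → s ≤ o → iterate p (iterate p x i) s ≢ r
        avoids s s≤o hits =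
          misses (i + s , s≤s (≤-trans (+-monoʳ-≤ i (m≤n⇒m≤1+n s≤o)) i+1+o≤n) , trans (iterate-+ p x i) hits)

    path-to-root : ∀ {ℓ} {R : Rel (Fin n) ℓ} → (∀ w → w ≢ r → R w (p w)) → ∀ x → Star R x r
    path-to-root {R = R} step x with orbit-reaches-root x
    ... | k , hits with least-witness (λ k → iterate p x k ≟ r) k hits
    ...   | j , _ , hitsʲ , earlier = subst (Star R x) hitsʲ (orbit-path p j x (λ s s<j → step _ (earlier s s<j)))

  parent-through : (∀ w → V S w ≡ true) → ∀ {b v} → A S b v ≡ true →
                   Σ[ p ∈ (Fin n → Fin n) ] (∀ w → w ≢ r → A S (p w) w ≡ true) × p v ≡ b
  parent-through spanning {b} {v} b→v =
    proj₁ ∘ choice , (λ w → proj₁ (proj₂ (choice w))) , proj₂ (proj₂ (choice v)) refl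
    where
      choice : ∀ w → Σ[ u ∈ Fin n ] (w ≢ r → A S u w ≡ true) × (w ≡ v → u ≡ b)
      choice w with w ≟ v
      ... | yes refl = b , const b→v , const refl
      ... | no w≢v with w ≟ r
      ...   | yes w≡r = r , (λ w≢r → contradiction w≡r w≢r) , (λ w≡v → contradiction w≡v w≢v)
      ...   | no w≢r  = proj₁ (in-arc w (spanning w) w≢r) , const (proj₂ (in-arc w (spanning w) w≢r))
                      , (λ w≡v → contradiction w≡v w≢v)

  -- Parent paths from a and from b (taking b as the parent of v) never use the edge {a, v}.
  in-arc-unique : (∀ w → V S w ≡ true) → ∀ {a b v} → A S a v ≡ true → A S b v ≡ true → a ≡ b
  in-arc-unique spanning {a} {b} {v} a→v b→v with a ≟ b | parent-through spanning b→v
  ... | yes a≡b | _                 = a≡b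
  ... | no a≢b  | p , p-arc , pv≡b = contradiction (detour⇒UCycle S a≢v (inj₁ a→v) walk) acyclic
    where
      a≢v : a ≢ v
      a≢v refl = not-¬ (loop-free a) a→v

      parent-step : ∀ w → w ≢ r → EdgeFree S a v w (p w)
      parent-step w w≢r = inj₂ (p-arc w w≢r)
        , (λ (w≡a , pw≡v) → antisymmetric a v (a→v , subst₂ (λ u w → A S u w ≡ true) pw≡v w≡a (p-arc w w≢r)))
        , (λ (w≡v , pw≡a) → a≢b (trans (sym pw≡a) (trans (cong p w≡v) pv≡b)))

      v→b : EdgeFree S a v v b
      v→b = inj₂ b→v , (λ (v≡a , _) → a≢v (sym v≡a)) , (λ (_ , b≡a) → a≢b (sym b≡a))

      walk : Star (EdgeFree S a v) v a
      walk = v→b ◅ path-to-root p p-arc parent-step b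
                 ◅◅ reverse (EdgeFree-sym {S = S}) (path-to-root p p-arc parent-step a)

OutTree-transfer : ∀ {n} {H H' : Digraph n} {S r} → (∀ u w → A S u w ≡ true → H' u w ≡ true) →
                   OutTree H S r → OutTree H' S r
OutTree-transfer arcs (subgraph , tree , source) =
  (λ u w u→w → let (Vu , Vw , _) = subgraph u w u→w in Vu , Vw , arcs u w u→w) , tree , source

TLOutBranching-arc : ∀ {n} {H : Digraph n} {T r L T'} → TLOutBranching H T r L T' →
                     ∀ u w → A T' u w ≡ true → H u w ≡ true
TLOutBranching-arc (_ , (subgraph , _) , _) u w u→w = proj₂ (proj₂ (subgraph u w u→w))

TLOutBranching-transfer : ∀ {n} {H H' : Digraph n} {T r L T'} → (∀ u w → A T' u w ≡ true → H' u w ≡ true) →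
                          TLOutBranching H T r L T' → TLOutBranching H' T r L T'
TLOutBranching-transfer arcs (spanning , out , T⊆T' , leaves) = spanning , OutTree-transfer arcs out , T⊆T' , leaves

IsML-transfer : ∀ {n} {H H' : Digraph n} {T r L} →
                (∀ T' → TLOutBranching H T r L T' → TLOutBranching H' T r L T') →
                (∀ T' → TLOutBranching H' T r L T' → TLOutBranching H T r L T') →
                ∀ {m} → IsML H T r L m → IsML H' T r L m
IsML-transfer to from (inj₁ (none , m≡0)) = inj₁ ((λ T' → none T' ∘ from T') , m≡0)
IsML-transfer to from (inj₂ ((T' , b , leaves) , max)) = inj₂ ((T' , to T' b , leaves) , λ T'' → max T'' ∘ from T'')

hat-⊆ : ∀ {n} {D : Digraph n} {T L} u w → hat D T L u w ≡ true → D u w ≡ true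
hat-⊆ {D = D} u w = ∧-conicalˡ (D u w) _

arc∈hat : ∀ {n} {D : Digraph n} {T L u w} → D u w ≡ true → L u ≡ false →
          V T w ≡ false ⊎ A T u w ≡ true → hat D T L u w ≡ true
arc∈hat Duw Lu (inj₁ Vw)  rewrite Duw | Lu | Vw  = refl
arc∈hat {T = T} {w = w} Duw Lu (inj₂ Auw) rewrite Duw | Lu | Auw = ∨-zeroʳ (not (V T w))

module _ {n} {D : Digraph n} {T : Sub n} {r : Fin n} {L : Fin n → Bool} (triple : Triple D T r L) where

  TLOutBranching-arcs-in-hat : ∀ {T'} → TLOutBranching D T r L T' → ∀ u w → A T' u w ≡ true → hat D T L u w ≡ true
  TLOutBranching-arcs-in-hat {T'} b@(spanning , out' , T⊆T' , L-leaves) u w u→w =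
    arc∈hat {D = D} {T} {L} (TLOutBranching-arc {T = T} b u w u→w) L-free head-condition
    where
      L-free : L u ≡ false
      L-free = ¬-not (λ Lu → not-¬ (leaf-has-no-out-arc {S = T'} w (L-leaves u Lu)) u→w)

      head-condition : V T w ≡ false ⊎ A T u w ≡ true
      head-condition with V T w in Vw | A T u w in Auw
      ... | false | _     = inj₁ refl
      ... | true  | true  = inj₂ refl
      ... | true  | false with w ≟ r
      ...   | yes refl = contradiction u→w (not-¬ (OutTreeProperties.root-has-no-in-arc out' u))
      ...   | no w≢r   =
        let (x , x→w) = OutTreeProperties.in-arc (proj₁ triple) w Vw w≢r
            x≡u       = OutTreeProperties.in-arc-unique out' spanning (T⊆T' x w x→w) u→w
        in contradiction (subst (λ y → A T y w ≡ true) x≡u x→w) (not-¬ Auw)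

lemma3 : ∀ {n : ℕ} (D : Digraph n) (T : Sub n) (r : Fin n) (L : Fin n → Bool)
    → Triple D T r L
    → ∀ (m : ℕ) → IsML D T r L m ⇔ IsML (hat D T L) T r L m
lemma3 D T r L triple m = mk⇔ (IsML-transfer {T = T} to from) (IsML-transfer {T = T} from to)
  where
    to : ∀ T' → TLOutBranching D T r L T' → TLOutBranching (hat D T L) T r L T'
    to T' b = TLOutBranching-transfer {T = T} (TLOutBranching-arcs-in-hat triple b) b

    from : ∀ T' → TLOutBranching (hat D T L) T r L T' → TLOutBranching D T r L T'
    from T' b = TLOutBranching-transfer {T = T} (λ u w → hat-⊆ {D = D} {T} {L} u w ∘ TLOutBranching-arc {T = T} b u w) b
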